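{- Let $n\ge1$ with $\beta(n)=b_1\cdots b_k$ and principal prefix of length $r$. Given $i\in\{1,\dots,r\}$, let $q,m$ be the unique nonnegative integers with $n=q\cdot2^{k-i}+m$ and $0\le m<2^{k-i}$. Let $c=\hat0(q)$, $d=\hat0(m)$ and $z=0^{k-\ell(c)-\ell(d)}$ (where $\ell(\cdot)$ is word length). Then the word $czd$ is a join-irreducible element of $\mathcal{D}(n)$. Moreover, every join-irreducible element of $\mathcal{D}(n)$ is of this form for some $i\in\{1,\dots,r\}$.
   Context: For $N\ge0$, $\beta(N)$ is the binary expansion of $N$, most significant digit first ($\beta(0)$ empty). The principal prefix of $\beta(n)=b_1\cdots b_k$ is $b_1\cdots b_r$, where $b_{r+1}$ is the rightmost $0$ ($r=0$ if none). A hyperbinary expansion of $N$ is a word over $\{0,1,2\}$ of the same length $K$ as $\beta(N)$, $d_1\cdots d_K$, with $\sum_id_i2^{K-i}=N$; it corresponds to the hyperbinary partition (parts powers of $2$, each at most twice) in which $2^{K-i}$ has multiplicity $d_i$. $\mathcal{D}(N)$ is the set of these ordered by transporting refinement of partitions ($\mu\le\lambda$ if the parts of $\lambda$ can be subdivided to produce the parts of $\mu$); it is a lattice with a minimum element denoted $\hat0(N)$ ($\hat0(0)$ is the empty word). $0^j$ denotes $j$ zeros. An element of a lattice is join-irreducible if it is not the minimum and is not the join of two strictly smaller elements. -}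

module Defs where

open import Data.Nat using (ℕ; zero; suc; _+_; _*_; _∸_; _^_; _≤_; _<_; _%_; _/_)
open import Data.List using (List; []; _∷_; reverse; length; replicate; _++_; concat)
open import Data.Nat.ListAction using (sum)
open import Data.Sum using (_⊎_)
open import Data.List.Relation.Unary.All using (All)
open import Data.List.Relation.Binary.Pointwise using (Pointwise)
open import Data.List.Relation.Binary.Permutation.Propositional using (_↭_)
open import Data.Maybe using (Maybe; just; nothing; maybe)
open import Data.Product using (Σ; _×_; ∃-syntax)
open import Relation.Binary.PropositionalEquality using (_≡_)
open import Relation.Nullary using (¬_)

-- binary digits, least significant first; fuel N suffices for N
toBinLE : ℕ → ℕ → List ℕ
toBinLE zero    _       = []
toBinLE (suc f) zero    = []
toBinLE (suc f) (suc n) = (suc n % 2) ∷ toBinLE f (suc n / 2)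

-- β(N): binary expansion, most significant digit first; β(0) = []
β : ℕ → List ℕ
β N = reverse (toBinLE N N)

-- 1-based position of the rightmost 0 of a word, if any
rightmostZero : List ℕ → Maybe ℕ
rightmostZero []       = nothing
rightmostZero (b ∷ bs) with rightmostZero bs
... | just p  = just (suc p)
... | nothing with b
...   | zero  = just 1
...   | suc _ = nothing

-- length r of the principal prefix of β(n): b_{r+1} is the rightmost 0, r = 0 if none
principalLength : ℕ → ℕ
principalLength n = maybe (λ p → p ∸ 1) 0 (rightmostZero (β n))

Word : Set
Word = List ℕ

val : Word → ℕ
val []       = 0
val (d ∷ ds) = d * 2 ^ length ds + val ds

InD : ℕ → Word → Set
InD N w = (length w ≡ length (β N)) × All (λ d → d ≤ 2) w × (val w ≡ N)

parts : Word → List ℕ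
parts []       = []
parts (d ∷ ds) = replicate d (2 ^ length ds) ++ parts ds

Refines : List ℕ → List ℕ → Set
Refines μ λs = ∃[ blocks ] (Pointwise (λ B l → sum B ≡ l) blocks λs × (concat blocks ↭ μ))

_≼_ : Word → Word → Set
u ≼ v = Refines (parts u) (parts v)

IsMin : ℕ → Word → Set
IsMin N w = InD N w × (∀ v → InD N v → w ≼ v)

IsJoin : ℕ → Word → Word → Word → Set
IsJoin N a b x = InD N x × a ≼ x × b ≼ x × (∀ u → InD N u → a ≼ u → b ≼ u → x ≼ u)

JoinIrreducible : ℕ → Word → Set
JoinIrreducible N x =
  InD N x
  × ¬ (∀ v → InD N v → x ≼ v)
  × (∀ a b → InD N a → InD N b → IsJoin N a b x → (a ≡ x) ⊎ (b ≡ x))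

czd : ℕ → Word → Word → Word
czd k c d = c ++ replicate (k ∸ length c ∸ length d) 0 ++ d

module Submission where

-- A word w ∈ 𝒟(N) is determined by its prefix values P_j w = val (w₁ ⋯ w_j), and u ≼ v holds
-- exactly when P_j u ≤ P_j v for all j: reducing all parts modulo 2^t shows that refinement can
-- only increase the value of the last t digits, and conversely a surplus in a leading digit of v
-- can be split into twice as many parts one position further on. So joins in 𝒟(N) are pointwise
-- maxima of prefix values. For t = β n every w ∈ 𝒟(n) has P_j t - 1 ≤ P_j w ≤ P_j t, with
-- equality beyond the principal prefix, and 0̂(n) lowers P_1 t, …, P_r t by one. The word c 0^z d
-- is the least element of 𝒟(n) with P_i = P_i t, hence join-irreducible; and every w is the join
-- of 0̂(n) with the words c 0^z d for those i ≤ r at which P_i w = P_i t, so a join-irreducible w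
-- is one of them.

open import Defs
open import Data.Nat using (ℕ; zero; suc; NonZero; _+_; _*_; _∸_; _^_; _≤_; _<_; _⊔_; _⊓_; _%_; _/_; _≟_; _≤?_; _<?_; z≤n; s≤s; s≤s⁻¹)
open import Data.Nat.Properties
open import Data.Nat.DivMod using (m%n<n; m%n≤m; m*n%n≡0; m<n⇒m%n≡m; %-distribˡ-+; m≡m%n+[m/n]*n; m/n<m)
open import Data.Nat.Tactic.RingSolver using (solve-∀)
open import Data.Nat.ListAction using (sum)
open import Data.Nat.ListAction.Properties using (sum-++; sum-↭)
open import Data.List using (List; []; _∷_; [_]; _++_; length; replicate; take; drop; map; concat; reverse; foldr; filter; applyUpTo)
open import Data.List.Properties using (drop-[]; length-++; length-take; length-drop; length-replicate; take++drop≡id; take-all; drop-all; map-++; concat-++; concat-map-[_]; ++-assoc; unfold-reverse; reverse-++)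
open import Data.List.Relation.Unary.All using (All; []; _∷_; tabulate) renaming (map to mapAll)
import Data.List.Relation.Unary.All.Properties as All
open import Data.List.Relation.Binary.Pointwise using (Pointwise; []; _∷_)
import Data.List.Relation.Binary.Pointwise as Pointwise
open import Data.List.Relation.Binary.Permutation.Propositional using (_↭_; ↭-reflexive; ↭-trans; ↭-sym)
import Data.List.Relation.Binary.Permutation.Propositional.Properties as ↭
open import Data.Product using (_×_; _,_; proj₁; proj₂; ∃-syntax)
open import Data.Sum using (_⊎_; inj₁; inj₂)
open import Data.List.Membership.Propositional using (_∈_)
open import Data.List.Membership.Propositional.Properties using (∈-map⁺; ∈-map⁻; ∈-filter⁺; ∈-filter⁻; ∈-applyUpTo⁺; ∈-applyUpTo⁻)
open import Data.List.Relation.Unary.Any using (here; there)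
open import Data.Empty using (⊥-elim)
open import Data.Maybe using (just; nothing; maybe)
open import Relation.Binary.PropositionalEquality using (_≡_; refl; sym; trans; cong; cong₂; subst; subst₂; module ≡-Reasoning)
open import Relation.Nullary using (¬_; Dec; yes; no)

2^≢0 : ∀ t → NonZero (2 ^ t)
2^≢0 t = m^n≢0 2 t

val-++ : ∀ u w → val (u ++ w) ≡ val u * 2 ^ length w + val w
val-++ []      w = refl
val-++ (a ∷ u) w = begin
  a * 2 ^ length (u ++ w) + val (u ++ w)
    ≡⟨ cong₂ (λ ℓ v → a * 2 ^ ℓ + v) (length-++ u) (val-++ u w) ⟩
  a * 2 ^ (length u + length w) + (val u * 2 ^ length w + val w)
    ≡⟨ cong (λ p → a * p + (val u * 2 ^ length w + val w)) (^-distribˡ-+-* 2 (length u) (length w)) ⟩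
  a * (2 ^ length u * 2 ^ length w) + (val u * 2 ^ length w + val w)
    ≡⟨ regroup a (2 ^ length u) (2 ^ length w) (val u) (val w) ⟩
  (a * 2 ^ length u + val u) * 2 ^ length w + val w ∎
  where
  open ≡-Reasoning
  regroup : ∀ a X Y v w → a * (X * Y) + (v * Y + w) ≡ (a * X + v) * Y + w
  regroup = solve-∀

val-singleton : ∀ d → val [ d ] ≡ d
val-singleton d = trans (+-identityʳ (d * 1)) (*-identityʳ d)

val-snoc : ∀ u d → val (u ++ [ d ]) ≡ 2 * val u + d
val-snoc u d = trans (val-++ u [ d ]) (cong₂ _+_ (*-comm (val u) 2) (val-singleton d))

val-zeros-++ : ∀ z w → val (replicate z 0 ++ w) ≡ val w
val-zeros-++ zero    w = refl
val-zeros-++ (suc z) w = val-zeros-++ z w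

replicate-+ : ∀ m n (x : ℕ) → replicate (m + n) x ≡ replicate m x ++ replicate n x
replicate-+ zero    n x = refl
replicate-+ (suc m) n x = cong (x ∷_) (replicate-+ m n x)

prefix : ℕ → Word → ℕ
prefix j w = val (take j w)

suffix : ℕ → Word → ℕ
suffix j w = val (drop j w)

val-prefix-suffix : ∀ j w → val w ≡ prefix j w * 2 ^ (length w ∸ j) + suffix j w
val-prefix-suffix j w = begin
  val w                                          ≡⟨ cong val (take++drop≡id j w) ⟨
  val (take j w ++ drop j w)                     ≡⟨ val-++ (take j w) (drop j w) ⟩
  prefix j w * 2 ^ length (drop j w) + suffix j w ≡⟨ cong (λ ℓ → prefix j w * 2 ^ ℓ + suffix j w) (length-drop j w) ⟩
  prefix j w * 2 ^ (length w ∸ j) + suffix j w   ∎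
  where open ≡-Reasoning

prefix-all : ∀ j w → length w ≤ j → prefix j w ≡ val w
prefix-all j w ℓ≤j = cong val (take-all j w ℓ≤j)

length-take-≤ : ∀ j (w : Word) → j ≤ length w → length (take j w) ≡ j
length-take-≤ j w j≤ℓ = trans (length-take j w) (m≤n⇒m⊓n≡m j≤ℓ)

take-++ : ∀ j (u w : Word) → take j (u ++ w) ≡ take j u ++ take (j ∸ length u) w
take-++ zero    []      w = refl
take-++ (suc j) []      w = refl
take-++ zero    (a ∷ u) w = refl
take-++ (suc j) (a ∷ u) w = cong (a ∷_) (take-++ j u w)

take-length-++ : ∀ (u w : Word) → take (length u) (u ++ w) ≡ u
take-length-++ []      w = refl
take-length-++ (a ∷ u) w = cong (a ∷_) (take-length-++ u w)

prefix-++ : ∀ j u w → prefix j (u ++ w) ≡ prefix j u * 2 ^ length (take (j ∸ length u) w) + prefix (j ∸ length u) w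
prefix-++ j u w = trans (cong val (take-++ j u w)) (val-++ (take j u) (take (j ∸ length u) w))

prefix-suc : ∀ {P : ℕ → Set} j w → suc j ≤ length w → All P w →
             ∃[ d ] P d × prefix (suc j) w ≡ 2 * prefix j w + d
prefix-suc zero    (a ∷ w) _ (pa ∷ _) = a , pa , val-singleton a
prefix-suc (suc j) (a ∷ w) (s≤s j<ℓ) (_ ∷ pw) with prefix-suc j w j<ℓ pw
... | d , pd , eq = d , pd , (begin
  a * 2 ^ length (take (suc j) w) + prefix (suc j) w
    ≡⟨ cong₂ (λ ℓ p → a * 2 ^ ℓ + p) (length-take-≤ (suc j) w j<ℓ) eq ⟩
  a * (2 * 2 ^ j) + (2 * prefix j w + d)
    ≡⟨ regroup a (2 ^ j) (prefix j w) d ⟩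
  2 * (a * 2 ^ j + prefix j w) + d
    ≡⟨ cong (λ ℓ → 2 * (a * 2 ^ ℓ + prefix j w) + d) (length-take-≤ j w (≤-trans (n≤1+n j) j<ℓ)) ⟨
  2 * (a * 2 ^ length (take j w) + prefix j w) + d ∎)
  where
  open ≡-Reasoning
  regroup : ∀ a X p d → a * (2 * X) + (2 * p + d) ≡ 2 * (a * X + p) + d
  regroup = solve-∀

1*n+n≡2*n : ∀ n → 1 * n + n ≡ 2 * n
1*n+n≡2*n = solve-∀

Binary : Word → Set
Binary = All (_≤ 1)

binary-val< : ∀ {w} → Binary w → val w < 2 ^ length w
binary-val< {[]}    []          = s≤s z≤n
binary-val< {a ∷ w} (a≤1 ∷ bw) = begin-strict
  a * X + val w <⟨ +-mono-≤-< (*-monoˡ-≤ X a≤1) (binary-val< bw) ⟩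
  1 * X + X     ≡⟨ 1*n+n≡2*n X ⟩
  2 * X         ∎
  where
  open ≤-Reasoning
  X = 2 ^ length w

hyperbinary-val≤ : ∀ {w} → All (_≤ 2) w → val w + 2 ≤ 2 * 2 ^ length w
hyperbinary-val≤ {[]}    []          = ≤-refl
hyperbinary-val≤ {a ∷ w} (a≤2 ∷ hw) = begin
  a * X + val w + 2   ≡⟨ +-assoc (a * X) (val w) 2 ⟩
  a * X + (val w + 2) ≤⟨ +-mono-≤ (*-monoˡ-≤ X a≤2) (hyperbinary-val≤ hw) ⟩
  2 * X + 2 * X       ≡⟨ double X ⟩
  2 * (2 * X)         ∎
  where
  open ≤-Reasoning
  X = 2 ^ length w
  double : ∀ X → 2 * X + 2 * X ≡ 2 * (2 * X)
  double = solve-∀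

ones-val : ∀ {w} → All (_≡ 1) w → suc (val w) ≡ 2 ^ length w
ones-val {[]}    []          = refl
ones-val {a ∷ w} (refl ∷ ow) = begin
  suc (1 * X + val w) ≡⟨ +-suc (1 * X) (val w) ⟨
  1 * X + suc (val w) ≡⟨ cong (1 * X +_) (ones-val ow) ⟩
  1 * X + X           ≡⟨ 1*n+n≡2*n X ⟩
  2 * X               ∎
  where
  open ≡-Reasoning
  X = 2 ^ length w

leading-zeros : ∀ z {ℓ} (w : Word) → length w ≡ z + ℓ → val w < 2 ^ ℓ → w ≡ replicate z 0 ++ drop z w
leading-zeros zero    w           _  _ = refl
leading-zeros (suc z) (zero ∷ w)  ℓ≡ w< = cong (0 ∷_) (leading-zeros z w (suc-injective ℓ≡) w<)
leading-zeros (suc z) {ℓ} (suc b ∷ w) ℓ≡ w< = ⊥-elim (<⇒≱ w< (begin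
  2 ^ ℓ                         ≤⟨ ^-monoʳ-≤ 2 (≤-trans (m≤n+m ℓ z) (≤-reflexive (sym (suc-injective ℓ≡)))) ⟩
  2 ^ length w                  ≤⟨ m≤m+n (2 ^ length w) (b * 2 ^ length w + val w) ⟩
  2 ^ length w + (b * 2 ^ length w + val w) ≡⟨ +-assoc (2 ^ length w) _ (val w) ⟨
  suc b * 2 ^ length w + val w  ∎))
  where open ≤-Reasoning

quotient-< : ∀ {a b k X s s'} → a * X + s ≡ b * X + s' → s' < k * X → a < b + k
quotient-< {a} {b} {k} {X} {s} {s'} eq s'<kX = *-cancelʳ-< X a (b + k) (begin-strict
  a * X          ≤⟨ m≤m+n (a * X) s ⟩
  a * X + s      ≡⟨ eq ⟩
  b * X + s'     <⟨ +-monoʳ-< (b * X) s'<kX ⟩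
  b * X + k * X  ≡⟨ *-distribʳ-+ X b k ⟨
  (b + k) * X    ∎)
  where open ≤-Reasoning

quotient-≤ : ∀ {a b X s s'} .{{_ : NonZero X}} → a * X + s ≡ b * X + s' → s' ≤ s → a ≤ b
quotient-≤ {a} {b} {X} {s} {s'} eq s'≤s = *-cancelʳ-≤ a b X (+-cancelʳ-≤ s (a * X) (b * X) (begin
  a * X + s  ≡⟨ eq ⟩
  b * X + s' ≤⟨ +-monoʳ-≤ (b * X) s'≤s ⟩
  b * X + s  ∎))
  where open ≤-Reasoning

remainder-≤ : ∀ {a b X s s'} → a * X + s ≡ b * X + s' → a ≤ b → s' ≤ s
remainder-≤ {a} {b} {X} {s} {s'} eq a≤b = +-cancelˡ-≤ (b * X) s' s (begin
  b * X + s' ≡⟨ eq ⟨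
  a * X + s  ≤⟨ +-monoˡ-≤ s (*-monoˡ-≤ X a≤b) ⟩
  b * X + s  ∎)
  where open ≤-Reasoning

divmod-unique : ∀ {a b X s s'} → a * X + s ≡ b * X + s' → s < X → s' < X → a ≡ b × s ≡ s'
divmod-unique {a} {b} {X} {s} {s'} eq s<X s'<X = a≡b , +-cancelˡ-≡ (a * X) s s' (trans eq (cong (λ c → c * X + s') (sym a≡b)))
  where
  a≡b : a ≡ b
  a≡b = ≤-antisym
    (s≤s⁻¹ (subst (a <_) (+-comm b 1) (quotient-< eq (subst (s' <_) (sym (*-identityˡ X)) s'<X))))
    (s≤s⁻¹ (subst (b <_) (+-comm a 1) (quotient-< (sym eq) (subst (s <_) (sym (*-identityˡ X)) s<X))))

carry : ∀ {a b X s s'} → a * X + s ≡ b * X + s' → a ≤ b → s ≡ (b ∸ a) * X + s'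
carry {a} {b} {X} {s} {s'} eq a≤b = +-cancelˡ-≡ (a * X) s ((b ∸ a) * X + s') (begin
  a * X + s                   ≡⟨ eq ⟩
  b * X + s'                  ≡⟨ cong (λ c → c * X + s') (m+[n∸m]≡n a≤b) ⟨
  (a + (b ∸ a)) * X + s'      ≡⟨ regroup a (b ∸ a) X s' ⟩
  a * X + ((b ∸ a) * X + s')  ∎)
  where
  open ≡-Reasoning
  regroup : ∀ a e X s → (a + e) * X + s ≡ a * X + (e * X + s)
  regroup = solve-∀

2^-reflects-< : ∀ {a b} → 2 ^ a < 2 ^ b → a < b
2^-reflects-< {a} {b} 2^a<2^b = ≰⇒> (λ b≤a → <⇒≱ 2^a<2^b (^-monoʳ-≤ 2 b≤a))

infixl 7 _%2^_
_%2^_ : ℕ → ℕ → ℕ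
x %2^ t = _%_ x (2 ^ t) {{2^≢0 t}}

residue : ℕ → List ℕ → ℕ
residue t xs = sum (map (_%2^ t) xs)

residue-++ : ∀ t xs ys → residue t (xs ++ ys) ≡ residue t xs + residue t ys
residue-++ t xs ys = trans (cong sum (map-++ (_%2^ t) xs ys)) (sum-++ (map (_%2^ t) xs) (map (_%2^ t) ys))

residue-replicate : ∀ t a x → residue t (replicate a x) ≡ a * (x %2^ t)
residue-replicate t zero    x = refl
residue-replicate t (suc a) x = cong (x %2^ t +_) (residue-replicate t a x)

residue-sum : ∀ t B → sum B %2^ t ≤ residue t B
residue-sum t []      = ≤-reflexive (m*n%n≡0 0 (2 ^ t) {{2^≢0 t}})
residue-sum t (x ∷ B) = begin
  (x + sum B) %2^ t                ≡⟨ %-distribˡ-+ x (sum B) (2 ^ t) {{2^≢0 t}} ⟩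
  (x %2^ t + sum B %2^ t) %2^ t    ≤⟨ m%n≤m (x %2^ t + sum B %2^ t) (2 ^ t) {{2^≢0 t}} ⟩
  x %2^ t + sum B %2^ t            ≤⟨ +-monoʳ-≤ (x %2^ t) (residue-sum t B) ⟩
  x %2^ t + residue t B            ∎
  where open ≤-Reasoning

SumsTo : List ℕ → ℕ → Set
SumsTo B l = sum B ≡ l

residue-refines : ∀ t {μ λs} → Refines μ λs → residue t λs ≤ residue t μ
residue-refines t (Bs , sums , perm) = ≤-trans (residue-concat sums) (≤-reflexive (sum-↭ (↭.map⁺ (_%2^ t) perm)))
  where
  residue-concat : ∀ {Bs ls} → Pointwise SumsTo Bs ls → residue t ls ≤ residue t (concat Bs)
  residue-concat []                    = z≤n
  residue-concat {B ∷ Bs} (refl ∷ sums) = subst (_ ≤_) (sym (residue-++ t B (concat Bs)))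
    (+-mono-≤ (residue-sum t B) (residue-concat sums))

residue-parts : ∀ t w → residue t (parts w) ≡ suffix (length w ∸ t) w
residue-parts t []      = cong val (sym (drop-[] (0 ∸ t)))
residue-parts t (a ∷ w) = begin
  residue t (replicate a (2 ^ length w) ++ parts w)            ≡⟨ residue-++ t (replicate a _) (parts w) ⟩
  residue t (replicate a (2 ^ length w)) + residue t (parts w) ≡⟨ cong₂ _+_ (residue-replicate t a _) (residue-parts t w) ⟩
  a * (2 ^ length w %2^ t) + suffix (length w ∸ t) w            ≡⟨ leading-digit (t ≤? length w) ⟩
  suffix (suc (length w) ∸ t) (a ∷ w)                          ∎
  where
  open ≡-Reasoning
  leading-digit : Dec (t ≤ length w) → a * (2 ^ length w %2^ t) + suffix (length w ∸ t) w ≡ suffix (suc (length w) ∸ t) (a ∷ w)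
  leading-digit (yes t≤ℓ) = begin
    a * (2 ^ length w %2^ t) + suffix (length w ∸ t) w ≡⟨ cong (λ x → a * x + suffix (length w ∸ t) w) 2^ℓ%2^t≡0 ⟩
    a * 0 + suffix (length w ∸ t) w                     ≡⟨ cong (_+ suffix (length w ∸ t) w) (*-zeroʳ a) ⟩
    suffix (length w ∸ t) w                             ≡⟨ cong (λ k → suffix k (a ∷ w)) (+-∸-assoc 1 t≤ℓ) ⟨
    suffix (suc (length w) ∸ t) (a ∷ w)                 ∎
    where
    2^ℓ%2^t≡0 : 2 ^ length w %2^ t ≡ 0
    2^ℓ%2^t≡0 = begin
      2 ^ length w %2^ t                    ≡⟨ cong (λ k → 2 ^ k %2^ t) (m∸n+n≡m t≤ℓ) ⟨
      2 ^ (length w ∸ t + t) %2^ t          ≡⟨ cong (_%2^ t) (^-distribˡ-+-* 2 (length w ∸ t) t) ⟩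
      (2 ^ (length w ∸ t) * 2 ^ t) %2^ t    ≡⟨ m*n%n≡0 (2 ^ (length w ∸ t)) (2 ^ t) {{2^≢0 t}} ⟩
      0                                     ∎
  leading-digit (no t≰ℓ) = begin
    a * (2 ^ length w %2^ t) + suffix (length w ∸ t) w ≡⟨ cong₂ (λ x k → a * x + suffix k w) 2^ℓ%2^t≡2^ℓ (m≤n⇒m∸n≡0 (<⇒≤ ℓ<t)) ⟩
    val (a ∷ w)                                        ≡⟨ cong (λ k → suffix k (a ∷ w)) (m≤n⇒m∸n≡0 ℓ<t) ⟨
    suffix (suc (length w) ∸ t) (a ∷ w)                ∎
    where
    ℓ<t = ≰⇒> t≰ℓ
    2^ℓ%2^t≡2^ℓ : 2 ^ length w %2^ t ≡ 2 ^ length w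
    2^ℓ%2^t≡2^ℓ = m<n⇒m%n≡m {{2^≢0 t}} (^-monoʳ-< 2 (s≤s (s≤s z≤n)) ℓ<t)

infix 4 _≤ₚ_
_≤ₚ_ : Word → Word → Set
u ≤ₚ v = ∀ j → prefix j u ≤ prefix j v

split-≡ : ∀ {u v} j → length u ≡ length v → val u ≡ val v →
          prefix j u * 2 ^ (length u ∸ j) + suffix j u ≡ prefix j v * 2 ^ (length u ∸ j) + suffix j v
split-≡ {u} {v} j ℓ≡ val≡ = begin
  prefix j u * 2 ^ (length u ∸ j) + suffix j u ≡⟨ val-prefix-suffix j u ⟨
  val u                                        ≡⟨ val≡ ⟩
  val v                                        ≡⟨ val-prefix-suffix j v ⟩
  prefix j v * 2 ^ (length v ∸ j) + suffix j v ≡⟨ cong (λ ℓ → prefix j v * 2 ^ (ℓ ∸ j) + suffix j v) ℓ≡ ⟨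
  prefix j v * 2 ^ (length u ∸ j) + suffix j v ∎
  where open ≡-Reasoning

suffix≥⇒≤ₚ : ∀ {u v} → length u ≡ length v → val u ≡ val v → (∀ j → suffix j v ≤ suffix j u) → u ≤ₚ v
suffix≥⇒≤ₚ {u} ℓ≡ val≡ suf≥ j = quotient-≤ {{2^≢0 (length u ∸ j)}} (split-≡ j ℓ≡ val≡) (suf≥ j)

≤ₚ⇒suffix≥ : ∀ {u v} → length u ≡ length v → val u ≡ val v → u ≤ₚ v → ∀ j → suffix j v ≤ suffix j u
≤ₚ⇒suffix≥ ℓ≡ val≡ u≤v j = remainder-≤ (split-≡ j ℓ≡ val≡) (u≤v j)

≤ₚ-++ : ∀ {u₁ u₂ w₁ w₂} → length u₁ ≡ length u₂ → length w₁ ≡ length w₂ → u₁ ≤ₚ u₂ → w₁ ≤ₚ w₂ → u₁ ++ w₁ ≤ₚ u₂ ++ w₂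
≤ₚ-++ {u₁} {u₂} {w₁} {w₂} ℓu ℓw u≤ w≤ j = begin
  prefix j (u₁ ++ w₁)                                  ≡⟨ prefix-++ j u₁ w₁ ⟩
  prefix j u₁ * 2 ^ length (take k₁ w₁) + prefix k₁ w₁  ≡⟨ cong (λ k → prefix j u₁ * 2 ^ length (take k w₁) + prefix k w₁) (cong (j ∸_) ℓu) ⟩
  prefix j u₁ * 2 ^ length (take k₂ w₁) + prefix k₂ w₁  ≡⟨ cong (λ ℓ → prefix j u₁ * 2 ^ ℓ + prefix k₂ w₁) ℓ-take ⟩
  prefix j u₁ * 2 ^ length (take k₂ w₂) + prefix k₂ w₁  ≤⟨ +-mono-≤ (*-monoˡ-≤ (2 ^ length (take k₂ w₂)) (u≤ j)) (w≤ k₂) ⟩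
  prefix j u₂ * 2 ^ length (take k₂ w₂) + prefix k₂ w₂  ≡⟨ prefix-++ j u₂ w₂ ⟨
  prefix j (u₂ ++ w₂)                                  ∎
  where
  open ≤-Reasoning
  k₁ = j ∸ length u₁
  k₂ = j ∸ length u₂
  ℓ-take : length (take k₂ w₁) ≡ length (take k₂ w₂)
  ℓ-take = trans (length-take k₂ w₁) (trans (cong (k₂ ⊓_) ℓw) (sym (length-take k₂ w₂)))

refines⇒suffix≥ : ∀ {u v} → length u ≡ length v → u ≼ v → ∀ j → suffix j v ≤ suffix j u
refines⇒suffix≥ {u} {v} ℓ≡ u≼v j with j ≤? length u
... | yes j≤ℓ = subst₂ _≤_ (last-digits v (sym ℓ≡)) (last-digits u refl) (residue-refines (length u ∸ j) u≼v)
  where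
  last-digits : ∀ w → length w ≡ length u → residue (length u ∸ j) (parts w) ≡ suffix j w
  last-digits w ℓw = trans (residue-parts (length u ∸ j) w)
    (trans (cong (λ k → suffix (k ∸ (length u ∸ j)) w) ℓw) (cong (λ k → suffix k w) (m∸[m∸n]≡n j≤ℓ)))
... | no j≰ℓ = subst (_≤ suffix j u) (cong val (sym (drop-all j v (subst (_≤ j) ℓ≡ (<⇒≤ (≰⇒> j≰ℓ)))))) z≤n

refines⇒≤ₚ : ∀ {u v} → length u ≡ length v → val u ≡ val v → u ≼ v → u ≤ₚ v
refines⇒≤ₚ ℓ≡ val≡ u≼v = suffix≥⇒≤ₚ ℓ≡ val≡ (refines⇒suffix≥ ℓ≡ u≼v)

refines-refl : ∀ xs → Refines xs xs
refines-refl xs = map [_] xs , singletons xs , ↭-reflexive (concat-map-[ xs ])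
  where
  singletons : ∀ xs → Pointwise SumsTo (map [_] xs) xs
  singletons []       = []
  singletons (x ∷ xs) = +-identityʳ x ∷ singletons xs

refines-++ : ∀ {μ₁ μ₂ λ₁ λ₂} → Refines μ₁ λ₁ → Refines μ₂ λ₂ → Refines (μ₁ ++ μ₂) (λ₁ ++ λ₂)
refines-++ (Bs₁ , sums₁ , perm₁) (Bs₂ , sums₂ , perm₂) =
  Bs₁ ++ Bs₂ , Pointwise.++⁺ sums₁ sums₂ , ↭-trans (↭-reflexive (sym (concat-++ Bs₁ Bs₂))) (↭.++⁺ perm₁ perm₂)

refines-pair : ∀ e Y ρ {μ} → Refines μ (replicate (2 * e) Y ++ ρ) → Refines μ (replicate e (2 * Y) ++ ρ)
refines-pair e Y ρ (Bs , sums , perm) =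
  let Bs' , sums' , concat≡ = pair-blocks e sums in Bs' , sums' , subst (_↭ _) (sym concat≡) perm
  where
  pair-blocks : ∀ e {Bs} → Pointwise SumsTo Bs (replicate (2 * e) Y ++ ρ) →
                ∃[ Bs' ] Pointwise SumsTo Bs' (replicate e (2 * Y) ++ ρ) × concat Bs' ≡ concat Bs
  pair-blocks zero    sums = _ , sums , refl
  pair-blocks (suc e) {Bs} sums with subst (λ k → Pointwise SumsTo Bs (replicate k Y ++ ρ)) (*-suc 2 e) sums
  ... | _∷_ {B₁} s₁ (_∷_ {B₂} s₂ sums') =
    let Bs' , sums'' , concat≡ = pair-blocks e sums' in
    (B₁ ++ B₂) ∷ Bs' , trans (sum-++ B₁ B₂) (cong₂ _+_ s₁ (trans s₂ (sym (+-identityʳ Y)))) ∷ sums'' ,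
    trans (cong ((B₁ ++ B₂) ++_) concat≡) (++-assoc B₁ B₂ _)

refines-carry : ∀ a e c u v → length u ≡ suc (length v) → u ≼ ((2 * e + c) ∷ v) → (a ∷ u) ≼ ((a + e) ∷ c ∷ v)
refines-carry a e c u v ℓ≡ u≼ = subst₂ Refines
  (cong (λ ℓ → replicate a (2 ^ ℓ) ++ parts u) (sym ℓ≡))
  (trans (sym (++-assoc (replicate a (2 * Y)) _ _)) (cong (_++ replicate c Y ++ parts v) (sym (replicate-+ a e (2 * Y)))))
  (refines-++ (refines-refl (replicate a (2 * Y))) (refines-pair e Y (replicate c Y ++ parts v) u≼'))
  where
  Y = 2 ^ length v
  u≼' : Refines (parts u) (replicate (2 * e) Y ++ replicate c Y ++ parts v)
  u≼' = subst (Refines (parts u)) (trans (cong (_++ parts v) (replicate-+ (2 * e) c Y)) (++-assoc (replicate (2 * e) Y) _ _)) u≼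

suffix≥⇒refines : ∀ u v → length u ≡ length v → val u ≡ val v → (∀ j → suffix j v ≤ suffix j u) → u ≼ v
suffix≥⇒refines []       []       _ _    _ = refines-refl []
suffix≥⇒refines (a ∷ []) (b ∷ []) _ val≡ _ =
  subst (λ x → [ a ] ≼ [ x ]) (trans (sym (val-singleton a)) (trans val≡ (val-singleton b))) (refines-refl _)
suffix≥⇒refines (a ∷ u₁ ∷ u) (b ∷ c ∷ v) ℓ≡ val≡ suf≥ =
  subst (λ x → (a ∷ u₁ ∷ u) ≼ (x ∷ c ∷ v)) (m+[n∸m]≡n a≤b)
    (refines-carry a e c (u₁ ∷ u) v ℓ' (suffix≥⇒refines (u₁ ∷ u) ((2 * e + c) ∷ v) ℓ' val-tail suf≥-tail))
  where
  Y = 2 ^ length v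
  X = 2 ^ length (u₁ ∷ u)
  e = b ∸ a
  ℓ' : length (u₁ ∷ u) ≡ length (c ∷ v)
  ℓ' = suc-injective ℓ≡
  val≡' : a * X + val (u₁ ∷ u) ≡ b * X + val (c ∷ v)
  val≡' = trans val≡ (cong (λ ℓ → b * 2 ^ ℓ + val (c ∷ v)) (sym ℓ'))
  a≤b : a ≤ b
  a≤b = quotient-≤ {{2^≢0 (length (u₁ ∷ u))}} val≡' (suf≥ 1)
  val-tail : val (u₁ ∷ u) ≡ val ((2 * e + c) ∷ v)
  val-tail = begin
    val (u₁ ∷ u)                   ≡⟨ carry val≡' a≤b ⟩
    e * X + val (c ∷ v)            ≡⟨ cong (λ ℓ → e * 2 ^ ℓ + val (c ∷ v)) ℓ' ⟩
    e * (2 * Y) + (c * Y + val v)  ≡⟨ regroup e c Y (val v) ⟩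
    (2 * e + c) * Y + val v        ∎
    where
    open ≡-Reasoning
    regroup : ∀ e c Y w → e * (2 * Y) + (c * Y + w) ≡ (2 * e + c) * Y + w
    regroup = solve-∀
  suf≥-tail : ∀ j → suffix j ((2 * e + c) ∷ v) ≤ suffix j (u₁ ∷ u)
  suf≥-tail zero    = ≤-reflexive (sym val-tail)
  suf≥-tail (suc j) = suf≥ (suc (suc j))

≤ₚ⇒refines : ∀ {u v} → length u ≡ length v → val u ≡ val v → u ≤ₚ v → u ≼ v
≤ₚ⇒refines {u} {v} ℓ≡ val≡ u≤v = suffix≥⇒refines u v ℓ≡ val≡ (≤ₚ⇒suffix≥ ℓ≡ val≡ u≤v)

HyperbinarySteps : (ℕ → ℕ) → ℕ → Set
HyperbinarySteps p K = ∀ j → j < K → 2 * p j ≤ p (suc j) × p (suc j) ≤ 2 * p j + 2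

hyperbinarySteps-prefix : ∀ {w} → All (_≤ 2) w → HyperbinarySteps (λ j → prefix j w) (length w)
hyperbinarySteps-prefix {w} hw j j<ℓ with prefix-suc j w j<ℓ hw
... | d , d≤2 , eq = subst (2 * prefix j w ≤_) (sym eq) (m≤m+n _ d) , subst (_≤ 2 * prefix j w + 2) (sym eq) (+-monoʳ-≤ _ d≤2)

fromPrefixes : (ℕ → ℕ) → ℕ → Word
fromPrefixes p zero    = []
fromPrefixes p (suc K) = fromPrefixes p K ++ [ p (suc K) ∸ 2 * p K ]

module _ {p : ℕ → ℕ} where

  length-fromPrefixes : ∀ K → length (fromPrefixes p K) ≡ K
  length-fromPrefixes zero    = refl
  length-fromPrefixes (suc K) = trans (length-++ (fromPrefixes p K)) (trans (+-comm _ 1) (cong suc (length-fromPrefixes K)))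

  take-fromPrefixes : ∀ {j K} → j ≤ K → take j (fromPrefixes p K) ≡ fromPrefixes p j
  take-fromPrefixes {j} {K} j≤K with m≤n⇒m<n∨m≡n j≤K
  ... | inj₂ refl       = take-all j (fromPrefixes p j) (≤-reflexive (length-fromPrefixes j))
  ... | inj₁ (s≤s j≤K') = trans (take-++-≤ (subst (j ≤_) (sym (length-fromPrefixes _)) j≤K')) (take-fromPrefixes j≤K')
    where
    take-++-≤ : ∀ {j} {xs ys : Word} → j ≤ length xs → take j (xs ++ ys) ≡ take j xs
    take-++-≤ {zero}              _         = refl
    take-++-≤ {suc j} {x ∷ xs} (s≤s j≤ℓ) = cong (x ∷_) (take-++-≤ j≤ℓ)

  val-fromPrefixes : ∀ {K} → p 0 ≡ 0 → HyperbinarySteps p K → val (fromPrefixes p K) ≡ p K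
  val-fromPrefixes {zero}  p0≡0 _     = sym p0≡0
  val-fromPrefixes {suc K} p0≡0 steps = begin
    val (fromPrefixes p K ++ [ p (suc K) ∸ 2 * p K ])   ≡⟨ val-snoc (fromPrefixes p K) _ ⟩
    2 * val (fromPrefixes p K) + (p (suc K) ∸ 2 * p K)   ≡⟨ cong (λ v → 2 * v + (p (suc K) ∸ 2 * p K)) (val-fromPrefixes p0≡0 steps<K) ⟩
    2 * p K + (p (suc K) ∸ 2 * p K)                      ≡⟨ m+[n∸m]≡n (proj₁ (steps K ≤-refl)) ⟩
    p (suc K)                                            ∎
    where
    open ≡-Reasoning
    steps<K : HyperbinarySteps p K
    steps<K j j<K = steps j (≤-trans j<K (n≤1+n K))

  prefix-fromPrefixes : ∀ {K j} → p 0 ≡ 0 → HyperbinarySteps p K → j ≤ K → prefix j (fromPrefixes p K) ≡ p j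
  prefix-fromPrefixes p0≡0 steps j≤K =
    trans (cong val (take-fromPrefixes j≤K)) (val-fromPrefixes p0≡0 (λ i i<j → steps i (≤-trans i<j j≤K)))

  digits-fromPrefixes : ∀ {K} → HyperbinarySteps p K → All (_≤ 2) (fromPrefixes p K)
  digits-fromPrefixes {zero}  _     = []
  digits-fromPrefixes {suc K} steps = All.++⁺ (digits-fromPrefixes (λ j j<K → steps j (≤-trans j<K (n≤1+n K))))
    (m≤n+o⇒m∸n≤o (p (suc K)) (2 * p K) (proj₂ (steps K ≤-refl)) ∷ [])

hyperbinarySteps-⊔ : ∀ {p q K} → HyperbinarySteps p K → HyperbinarySteps q K → HyperbinarySteps (λ j → p j ⊔ q j) K
hyperbinarySteps-⊔ {p} {q} steps-p steps-q j j<K =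
  subst (_≤ p (suc j) ⊔ q (suc j)) (sym (*-distribˡ-⊔ 2 (p j) (q j))) (⊔-mono-≤ (proj₁ (steps-p j j<K)) (proj₁ (steps-q j j<K))) ,
  subst (p (suc j) ⊔ q (suc j) ≤_) (trans (sym (+-distribʳ-⊔ 2 (2 * p j) (2 * q j))) (cong (_+ 2) (sym (*-distribˡ-⊔ 2 (p j) (q j)))))
    (⊔-mono-≤ (proj₂ (steps-p j j<K)) (proj₂ (steps-q j j<K)))

prefix-injective : ∀ {u v} → length u ≡ length v → (∀ j → prefix j u ≡ prefix j v) → u ≡ v
prefix-injective {[]}    {[]}    _  _   = refl
prefix-injective {a ∷ u} {b ∷ v} ℓ≡ eq = cong₂ _∷_ a≡b (prefix-injective (suc-injective ℓ≡) tail≡)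
  where
  a≡b : a ≡ b
  a≡b = trans (sym (val-singleton a)) (trans (eq 1) (val-singleton b))
  tail≡ : ∀ j → prefix j u ≡ prefix j v
  tail≡ j = +-cancelˡ-≡ (a * 2 ^ length (take j u)) (prefix j u) (prefix j v) (trans (eq (suc j))
    (cong₂ (λ d ℓ → d * 2 ^ ℓ + prefix j v) (sym a≡b)
      (trans (length-take j v) (trans (cong (j ⊓_) (sym (suc-injective ℓ≡))) (sym (length-take j u))))))

module Lattice (N : ℕ) where

  K : ℕ
  K = length (β N)

  module _ {u v : Word} (u∈ : InD N u) (v∈ : InD N v) where

    length-≡ : length u ≡ length v
    length-≡ = trans (proj₁ u∈) (sym (proj₁ v∈))

    val-≡ : val u ≡ val v
    val-≡ = trans (proj₂ (proj₂ u∈)) (sym (proj₂ (proj₂ v∈)))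

    ≼⇒≤ₚ : u ≼ v → u ≤ₚ v
    ≼⇒≤ₚ = refines⇒≤ₚ length-≡ val-≡

    ≤ₚ⇒≼ : u ≤ₚ v → u ≼ v
    ≤ₚ⇒≼ = ≤ₚ⇒refines length-≡ val-≡

    ≤ₚ-antisym : u ≤ₚ v → v ≤ₚ u → u ≡ v
    ≤ₚ-antisym u≤v v≤u = prefix-injective length-≡ (λ j → ≤-antisym (u≤v j) (v≤u j))

  prefix-beyond : ∀ {w j} → InD N w → K ≤ j → prefix j w ≡ N
  prefix-beyond {w} {j} (ℓw , _ , vw) K≤j = trans (prefix-all j w (subst (_≤ j) (sym ℓw) K≤j)) vw

  hyperbinarySteps-InD : ∀ {w} → InD N w → HyperbinarySteps (λ j → prefix j w) K
  hyperbinarySteps-InD {w} (ℓw , hw , _) = subst (HyperbinarySteps (λ j → prefix j w)) ℓw (hyperbinarySteps-prefix hw)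

  infixr 6 _∨_
  _∨_ : Word → Word → Word
  a ∨ b = fromPrefixes (λ j → prefix j a ⊔ prefix j b) K

  module _ {a b : Word} (a∈ : InD N a) (b∈ : InD N b) where

    private
      steps : HyperbinarySteps (λ j → prefix j a ⊔ prefix j b) K
      steps = hyperbinarySteps-⊔ {λ j → prefix j a} {λ j → prefix j b} (hyperbinarySteps-InD a∈) (hyperbinarySteps-InD b∈)

    ∨-InD : InD N (a ∨ b)
    ∨-InD = length-fromPrefixes K , digits-fromPrefixes steps ,
      trans (val-fromPrefixes refl steps) (trans (cong₂ _⊔_ (prefix-beyond a∈ ≤-refl) (prefix-beyond b∈ ≤-refl)) (⊔-idem N))

    prefix-∨ : ∀ j → prefix j (a ∨ b) ≡ prefix j a ⊔ prefix j b
    prefix-∨ j with j ≤? K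
    ... | yes j≤K = prefix-fromPrefixes refl steps j≤K
    ... | no j≰K  = trans (prefix-beyond ∨-InD K≤j)
      (sym (trans (cong₂ _⊔_ (prefix-beyond a∈ K≤j) (prefix-beyond b∈ K≤j)) (⊔-idem N)))
      where K≤j = <⇒≤ (≰⇒> j≰K)

    ≤ₚ-∨ˡ : a ≤ₚ a ∨ b
    ≤ₚ-∨ˡ j = subst (prefix j a ≤_) (sym (prefix-∨ j)) (m≤m⊔n _ _)

    ≤ₚ-∨ʳ : b ≤ₚ a ∨ b
    ≤ₚ-∨ʳ j = subst (prefix j b ≤_) (sym (prefix-∨ j)) (m≤n⊔m _ _)

    ∨-least : ∀ {w} → a ≤ₚ w → b ≤ₚ w → a ∨ b ≤ₚ w
    ∨-least a≤w b≤w j = subst (_≤ _) (sym (prefix-∨ j)) (⊔-lub (a≤w j) (b≤w j))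

    ∨-isJoin : IsJoin N a b (a ∨ b)
    ∨-isJoin = ∨-InD , ≤ₚ⇒≼ a∈ ∨-InD ≤ₚ-∨ˡ , ≤ₚ⇒≼ b∈ ∨-InD ≤ₚ-∨ʳ ,
      λ w w∈ a≼w b≼w → ≤ₚ⇒≼ ∨-InD w∈ (∨-least (≼⇒≤ₚ a∈ w∈ a≼w) (≼⇒≤ₚ b∈ w∈ b≼w))

  module _ {z : Word} (z∈ : InD N z) where

    foldr-∨-InD : ∀ {ys} → All (InD N) ys → InD N (foldr _∨_ z ys)
    foldr-∨-InD []          = z∈
    foldr-∨-InD (y∈ ∷ ys∈) = ∨-InD y∈ (foldr-∨-InD ys∈)

    ∈⇒≤ₚ-foldr-∨ : ∀ {y ys} → All (InD N) ys → y ∈ ys → y ≤ₚ foldr _∨_ z ys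
    ∈⇒≤ₚ-foldr-∨ (y∈ ∷ ys∈) (here refl) = ≤ₚ-∨ˡ y∈ (foldr-∨-InD ys∈)
    ∈⇒≤ₚ-foldr-∨ (y'∈ ∷ ys∈) (there y∈ys) j =
      ≤-trans (∈⇒≤ₚ-foldr-∨ ys∈ y∈ys j) (≤ₚ-∨ʳ y'∈ (foldr-∨-InD ys∈) j)

    foldr-∨-least : ∀ {w ys} → All (InD N) ys → z ≤ₚ w → All (_≤ₚ w) ys → foldr _∨_ z ys ≤ₚ w
    foldr-∨-least []          z≤w []            = z≤w
    foldr-∨-least (y∈ ∷ ys∈) z≤w (y≤w ∷ ys≤w) = ∨-least y∈ (foldr-∨-InD ys∈) y≤w (foldr-∨-least ys∈ z≤w ys≤w)

  joinIrreducible-∈ : ∀ {x z ys} → JoinIrreducible N x → IsMin N z → All (InD N) ys → x ≡ foldr _∨_ z ys → x ∈ ys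
  joinIrreducible-∈ (_ , notMin , _) (_ , z-least) [] refl = ⊥-elim (notMin z-least)
  joinIrreducible-∈ {z = z} {ys = y ∷ ys} x-ji@(_ , _ , irreducible) z-min (y∈ ∷ ys∈) x≡
    with irreducible y (foldr _∨_ z ys) y∈ (foldr-∨-InD (proj₁ z-min) ys∈)
           (subst (IsJoin N y (foldr _∨_ z ys)) (sym x≡) (∨-isJoin y∈ (foldr-∨-InD (proj₁ z-min) ys∈)))
  ... | inj₁ y≡x    = here (sym y≡x)
  ... | inj₂ rest≡x = there (joinIrreducible-∈ x-ji z-min ys∈ (sym rest≡x))

half≤fuel : ∀ f n → suc n ≤ suc f → suc n / 2 ≤ f
half≤fuel f n (s≤s n≤f) = ≤-trans (s≤s⁻¹ (m/n<m (suc n) 2 (s≤s (s≤s z≤n)))) n≤f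

val-reverse-toBinLE : ∀ f N → N ≤ f → val (reverse (toBinLE f N)) ≡ N
val-reverse-toBinLE zero    zero    _    = refl
val-reverse-toBinLE (suc f) zero    _    = refl
val-reverse-toBinLE (suc f) (suc n) n<f = begin
  val (reverse (suc n % 2 ∷ toBinLE f (suc n / 2)))        ≡⟨ cong val (unfold-reverse (suc n % 2) (toBinLE f (suc n / 2))) ⟩
  val (reverse (toBinLE f (suc n / 2)) ++ [ suc n % 2 ])   ≡⟨ val-snoc (reverse (toBinLE f (suc n / 2))) (suc n % 2) ⟩
  2 * val (reverse (toBinLE f (suc n / 2))) + suc n % 2    ≡⟨ cong (λ h → 2 * h + suc n % 2) (val-reverse-toBinLE f (suc n / 2) (half≤fuel f n n<f)) ⟩
  2 * (suc n / 2) + suc n % 2                              ≡⟨ trans (+-comm (2 * (suc n / 2)) _) (cong (suc n % 2 +_) (*-comm 2 (suc n / 2))) ⟩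
  suc n % 2 + suc n / 2 * 2                                ≡⟨ m≡m%n+[m/n]*n (suc n) 2 ⟨
  suc n                                                    ∎
  where open ≡-Reasoning

binary-toBinLE : ∀ f N → Binary (toBinLE f N)
binary-toBinLE zero    N       = []
binary-toBinLE (suc f) zero    = []
binary-toBinLE (suc f) (suc n) = s≤s⁻¹ (m%n<n (suc n) 2) ∷ binary-toBinLE f (suc n / 2)

toBinLE-ends-with-1 : ∀ f N → 1 ≤ N → N ≤ f → ∃[ xs ] toBinLE f N ≡ xs ++ [ 1 ]
toBinLE-ends-with-1 (suc f) (suc n) _ n<f with suc n / 2 in half≡
... | zero = [] , cong₂ _∷_ last-digit (toBinLE-0 f)
  where
  toBinLE-0 : ∀ f → toBinLE f 0 ≡ []
  toBinLE-0 zero    = refl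
  toBinLE-0 (suc f) = refl
  last-digit : suc n % 2 ≡ 1
  last-digit = ≤-antisym (s≤s⁻¹ (m%n<n (suc n) 2))
    (subst (1 ≤_) (trans (m≡m%n+[m/n]*n (suc n) 2) (trans (cong (λ h → suc n % 2 + h * 2) half≡) (+-identityʳ _))) (s≤s z≤n))
... | suc h with toBinLE-ends-with-1 f (suc h) (s≤s z≤n) (subst (_≤ f) half≡ (half≤fuel f n n<f))
...   | xs , eq = suc n % 2 ∷ xs , cong (suc n % 2 ∷_) eq

val-β : ∀ N → val (β N) ≡ N
val-β N = val-reverse-toBinLE N N ≤-refl

β-binary : ∀ N → Binary (β N)
β-binary N = ↭.All-resp-↭ (↭-sym (↭.↭-reverse (toBinLE N N))) (binary-toBinLE N N)

β-InD : ∀ N → InD N (β N)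
β-InD N = refl , mapAll (λ d≤1 → ≤-trans d≤1 (s≤s z≤n)) (β-binary N) , val-β N

β-leading-1 : ∀ {N} → 1 ≤ N → ∃[ xs ] β N ≡ 1 ∷ xs
β-leading-1 {N} 1≤N with toBinLE-ends-with-1 N N 1≤N ≤-refl
... | xs , eq = reverse xs , trans (cong reverse eq) (reverse-++ xs [ 1 ])

β-bound : ∀ N → N < 2 ^ length (β N)
β-bound N = subst (_< 2 ^ length (β N)) (val-β N) (binary-val< (β-binary N))

β-split : ∀ N i → N ≡ prefix i (β N) * 2 ^ (length (β N) ∸ i) + suffix i (β N)
β-split N i = trans (sym (val-β N)) (val-prefix-suffix i (β N))

suffix-β< : ∀ N i → suffix i (β N) < 2 ^ (length (β N) ∸ i)
suffix-β< N i = subst (λ ℓ → suffix i (β N) < 2 ^ ℓ) (length-drop i (β N)) (binary-val< (All.drop⁺ i (β-binary N)))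

leading-1-val : ∀ xs → 2 ^ length xs ≤ val (1 ∷ xs)
leading-1-val xs = ≤-trans (≤-reflexive (sym (*-identityˡ _))) (m≤m+n (1 * 2 ^ length xs) (val xs))

length-β≤ : ∀ {N a} → N < 2 ^ a → length (β N) ≤ a
length-β≤ {zero}  _ = z≤n
length-β≤ {suc N} N<2^a with β-leading-1 {suc N} (s≤s z≤n)
... | xs , β≡ = subst (λ w → length w ≤ _) (sym β≡) (2^-reflects-< (≤-<-trans
      (subst (2 ^ length xs ≤_) (trans (cong val (sym β≡)) (val-β (suc N))) (leading-1-val xs)) N<2^a))

length-β-leading-1 : ∀ {xs} → Binary xs → length (β (val (1 ∷ xs))) ≡ suc (length xs)
length-β-leading-1 {xs} bxs = ≤-antisym
  (length-β≤ (binary-val< {1 ∷ xs} (≤-refl ∷ bxs)))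
  (2^-reflects-< (≤-<-trans (leading-1-val xs) (β-bound (val (1 ∷ xs)))))

length-β-prefix : ∀ {n i} → 1 ≤ n → 1 ≤ i → i ≤ length (β n) → length (β (prefix i (β n))) ≡ i
length-β-prefix {n} {suc i} 1≤n _ i<K with β-leading-1 1≤n
... | xs , β≡ = subst (λ t → length (β (prefix (suc i) t)) ≡ suc i) (sym β≡)
  (trans (length-β-leading-1 (All.take⁺ i (tail-binary (subst Binary β≡ (β-binary n)))))
         (cong suc (length-take-≤ i xs (s≤s⁻¹ (subst (λ t → suc i ≤ length t) β≡ i<K)))))
  where
  tail-binary : Binary (1 ∷ xs) → Binary xs
  tail-binary (_ ∷ bxs) = bxs

prefix-β-positive : ∀ {n} j → 1 ≤ n → 1 ≤ prefix (suc j) (β n)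
prefix-β-positive {n} j 1≤n with β-leading-1 1≤n
... | xs , β≡ = subst (λ w → 1 ≤ prefix (suc j) w) (sym β≡)
  (≤-trans (m^n>0 2 (length (take j xs))) (≤-trans (≤-reflexive (sym (*-identityˡ _))) (m≤m+n _ (prefix j xs))))

rightmostZero-view : ∀ {w} → Binary w →
  (All (_≡ 1) w × rightmostZero w ≡ nothing) ⊎
  (∃[ u ] ∃[ v ] w ≡ u ++ 0 ∷ v × rightmostZero w ≡ just (suc (length u)) × All (_≡ 1) v)
rightmostZero-view {[]}    []          = inj₁ ([] , refl)
rightmostZero-view {b ∷ w} (b≤1 ∷ bw) with rightmostZero w | rightmostZero-view bw
... | just _  | inj₂ (u , v , refl , refl , ones) = inj₂ (b ∷ u , v , refl , refl , ones)
... | nothing | inj₁ (ones , _) with b | b≤1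
...   | zero        | _      = inj₂ ([] , w , refl , refl , ones)
...   | suc zero    | _      = inj₁ (refl ∷ ones , refl)
...   | suc (suc _) | s≤s ()

-- When β n has no 0, digit is its leading 1 (and the principal prefix is empty).
record PrincipalDecomposition (n : ℕ) : Set where
  field
    before : Word
    digit  : ℕ
    after  : Word
    β≡             : β n ≡ before ++ digit ∷ after
    length-before  : length before ≡ principalLength n
    after-ones     : All (_≡ 1) after
    digit≡0        : 1 ≤ principalLength n → digit ≡ 0

principal-decomposition : ∀ {n} → 1 ≤ n → PrincipalDecomposition n
principal-decomposition {n} 1≤n with rightmostZero-view (β-binary n)
... | inj₂ (u , v , β≡ , rz≡ , ones) = record
  { before = u ; digit = 0 ; after = v
  ; β≡ = β≡ ; length-before = cong (maybe (λ p → p ∸ 1) 0) (sym rz≡) ; after-ones = ones ; digit≡0 = λ _ → refl }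
... | inj₁ (ones , rz≡) with β-leading-1 1≤n
...   | xs , β≡ = record
  { before = [] ; digit = 1 ; after = xs
  ; β≡ = β≡ ; length-before = r≡0 ; after-ones = tail-ones (subst (All (_≡ 1)) β≡ ones) ; digit≡0 = λ 1≤r → ⊥-elim (<-irrefl r≡0 1≤r) }
  where
  r≡0 : 0 ≡ principalLength n
  r≡0 = cong (maybe (λ p → p ∸ 1) 0) (sym rz≡)
  tail-ones : All (_≡ 1) (1 ∷ xs) → All (_≡ 1) xs
  tail-ones (_ ∷ ones) = ones

data Region (r : ℕ) : ℕ → Set where
  origin : Region r zero
  inside : ∀ {j} → j < r → Region r (suc j)
  beyond : ∀ {j} → r < j → Region r j

region : ∀ r j → Region r j
region r zero    = origin
region r (suc j) with j <? r
... | yes j<r = inside j<r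
... | no  j≮r = beyond (s≤s (≮⇒≥ j≮r))

deficit : ∀ {r j} → Region r j → ℕ
deficit (inside _) = 1
deficit _          = 0

deficit-beyond : ∀ {r j} → r < j → (R : Region r j) → deficit R ≡ 0
deficit-beyond r<j origin         = refl
deficit-beyond r<j (inside j<r)   = ⊥-elim (<⇒≱ j<r (s≤s⁻¹ r<j))
deficit-beyond r<j (beyond _)     = refl

module Principal (n : ℕ) (1≤n : 1 ≤ n) where

  t : Word
  t = β n

  K : ℕ
  K = length t

  r : ℕ
  r = principalLength n

  open PrincipalDecomposition (principal-decomposition 1≤n)
    renaming (before to u; digit to d; after to v; β≡ to t≡; length-before to ℓu≡r)

  private
    K≡ : K ≡ suc (r + length v)
    K≡ = trans (cong length t≡) (trans (length-++ u) (trans (+-suc (length u) (length v)) (cong (λ ℓ → suc (ℓ + length v)) ℓu≡r)))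

  r<K : r < K
  r<K = subst (r <_) (sym K≡) (s≤s (m≤m+n r (length v)))

  suffix-β-after-principal : ∀ {j} → r < j → suc (suffix j t) ≡ 2 ^ (K ∸ j)
  suffix-β-after-principal {j} r<j = trans (ones-val (subst (All (_≡ 1)) (sym drop≡) (All.drop⁺ (j ∸ suc r) after-ones)))
    (cong (2 ^_) (length-drop j t))
    where
    drop≡ : drop j t ≡ drop (j ∸ suc r) v
    drop≡ = begin
      drop j t                                      ≡⟨ cong (λ w → drop j w) t≡ ⟩
      drop j (u ++ d ∷ v)                            ≡⟨ cong (λ k → drop k (u ++ d ∷ v)) (m+[n∸m]≡n r<j) ⟨
      drop (suc r + (j ∸ suc r)) (u ++ d ∷ v)        ≡⟨ cong (λ ℓ → drop (suc ℓ + (j ∸ suc r)) (u ++ d ∷ v)) ℓu≡r ⟨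
      drop (suc (length u) + (j ∸ suc r)) (u ++ d ∷ v) ≡⟨ drop-past u ⟩
      drop (j ∸ suc r) v                             ∎
      where
      open ≡-Reasoning
      drop-past : ∀ u → drop (suc (length u) + (j ∸ suc r)) (u ++ d ∷ v) ≡ drop (j ∸ suc r) v
      drop-past []      = refl
      drop-past (_ ∷ u) = drop-past u

  prefix-suc-principal : 1 ≤ r → prefix (suc r) t ≡ 2 * prefix r t
  prefix-suc-principal 1≤r = begin
    prefix (suc r) t                   ≡⟨ cong (λ w → prefix (suc r) w) t≡ ⟩
    prefix (suc r) (u ++ d ∷ v)        ≡⟨ cong (λ ℓ → prefix (suc ℓ) (u ++ d ∷ v)) ℓu≡r ⟨
    val (take (suc (length u)) (u ++ d ∷ v)) ≡⟨ cong val (take-past u) ⟩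
    val (u ++ [ d ])                   ≡⟨ val-snoc u d ⟩
    2 * val u + d                      ≡⟨ cong₂ (λ p e → 2 * p + e) (cong val (take-length-++ u (d ∷ v))) (sym (digit≡0 1≤r)) ⟨
    2 * val (take (length u) (u ++ d ∷ v)) + 0 ≡⟨ +-identityʳ _ ⟩
    2 * prefix (length u) (u ++ d ∷ v) ≡⟨ cong₂ (λ ℓ w → 2 * prefix ℓ w) ℓu≡r (sym t≡) ⟩
    2 * prefix r t                     ∎
    where
    open ≡-Reasoning
    take-past : ∀ u → take (suc (length u)) (u ++ d ∷ v) ≡ u ++ [ d ]
    take-past []      = refl
    take-past (a ∷ u) = cong (a ∷_) (take-past u)

  module _ {w : Word} (w∈ : InD n w) where

    private
      X : ℕ → ℕ
      X j = 2 ^ (K ∸ j)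

      split : ∀ j → prefix j w * X j + suffix j w ≡ prefix j t * X j + suffix j t
      split j = subst (λ ℓ → prefix j w * 2 ^ (ℓ ∸ j) + suffix j w ≡ prefix j t * 2 ^ (ℓ ∸ j) + suffix j t) (proj₁ w∈)
        (split-≡ j (Lattice.length-≡ n w∈ (β-InD n)) (Lattice.val-≡ n w∈ (β-InD n)))

      suffix-w-bound : ∀ j → suffix j w + 2 ≤ 2 * X j
      suffix-w-bound j = subst (λ ℓ → suffix j w + 2 ≤ 2 * 2 ^ ℓ) (trans (length-drop j w) (cong (_∸ j) (proj₁ w∈)))
        (hyperbinary-val≤ (All.drop⁺ j (proj₁ (proj₂ w∈))))

    prefix≡⇒suffix≡ : ∀ {j} → prefix j w ≡ prefix j t → suffix j w ≡ suffix j t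
    prefix≡⇒suffix≡ {j} prefix≡ = +-cancelˡ-≡ (prefix j t * X j) (suffix j w) (suffix j t)
      (trans (cong (λ p → p * X j + suffix j w) (sym prefix≡)) (split j))

    prefix≤β : ∀ j → prefix j w ≤ prefix j t
    prefix≤β j = s≤s⁻¹ (subst (prefix j w <_) (+-comm (prefix j t) 1)
      (quotient-< (split j) (subst (suffix j t <_) (sym (*-identityˡ (X j))) (suffix-β< n j))))

    β≤1+prefix : ∀ j → prefix j t ≤ suc (prefix j w)
    β≤1+prefix j = s≤s⁻¹ (subst (prefix j t <_) (+-comm (prefix j w) 2)
      (quotient-< (sym (split j)) (≤-trans (≤-reflexive (+-comm 1 (suffix j w))) (≤-trans (+-monoʳ-≤ (suffix j w) (s≤s z≤n)) (suffix-w-bound j)))))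

    -- Past the principal prefix the digits of β n are all 1, so a deficit in the prefix of w
    -- would force its suffix to exceed the largest hyperbinary value 2 (2^(K-j) - 1).
    prefix-after-principal : ∀ {j} → r < j → prefix j w ≡ prefix j t
    prefix-after-principal {j} r<j with prefix j t ∸ prefix j w in gap≡
    ... | zero  = ≤-antisym (prefix≤β j) (m∸n≡0⇒m≤n gap≡)
    ... | suc g = ⊥-elim (<-irrefl refl (begin-strict
      2 * X j                          ≡⟨ cong (X j +_) (+-identityʳ (X j)) ⟩
      X j + X j                        ≡⟨ cong (X j +_) (suffix-β-after-principal r<j) ⟨
      X j + suc (suffix j t)           <⟨ +-monoʳ-< (X j) (n<1+n _) ⟩
      X j + (2 + suffix j t)           ≡⟨ trans (cong (X j +_) (+-comm 2 (suffix j t))) (sym (+-assoc (X j) (suffix j t) 2)) ⟩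
      X j + suffix j t + 2             ≤⟨ +-monoˡ-≤ 2 (+-monoˡ-≤ (suffix j t) (m≤m+n (X j) (g * X j))) ⟩
      suc g * X j + suffix j t + 2     ≡⟨ cong (λ s → s + 2) (trans (carry (split j) (prefix≤β j)) (cong (λ c → c * X j + suffix j t) gap≡)) ⟨
      suffix j w + 2                   ≤⟨ suffix-w-bound j ⟩
      2 * X j                          ∎))
      where open ≤-Reasoning

  minPrefix : ℕ → ℕ
  minPrefix j = prefix j t ∸ deficit (region r j)

  minPrefix-steps : HyperbinarySteps minPrefix K
  minPrefix-steps j j<K with prefix-suc j t j<K (β-binary n)
  ... | d , d≤1 , t-step = steps (region r j) (region r (suc j)) t-step
    where
    d≤2 : d ≤ 2
    d≤2 = ≤-trans d≤1 (s≤s z≤n)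
    lowered-step : ∀ {P P'} → 1 ≤ P → P' ≡ 2 * P + d → 2 * (P ∸ 1) ≤ P' ∸ 1 × P' ∸ 1 ≤ 2 * (P ∸ 1) + 2
    lowered-step {suc P₀} _ refl = subst (λ p → 2 * P₀ ≤ p × p ≤ 2 * P₀ + 2) (sym (cong (_∸ 1) (regroup P₀ d)))
      (m≤m+n _ (suc d) , +-monoʳ-≤ (2 * P₀) (s≤s d≤1))
      where
      regroup : ∀ P₀ d → 2 * suc P₀ + d ≡ suc (2 * P₀ + suc d)
      regroup = solve-∀
    lowered-double : ∀ {P P'} → 1 ≤ P → P' ≡ 2 * P → 2 * (P ∸ 1) ≤ P' × P' ≤ 2 * (P ∸ 1) + 2
    lowered-double {suc P₀} _ refl = *-monoʳ-≤ 2 (n≤1+n P₀) , ≤-reflexive (regroup P₀)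
      where
      regroup : ∀ P₀ → 2 * suc P₀ ≡ 2 * P₀ + 2
      regroup = solve-∀
    steps : ∀ {j} (R : Region r j) (R' : Region r (suc j)) → prefix (suc j) t ≡ 2 * prefix j t + d →
            2 * (prefix j t ∸ deficit R) ≤ prefix (suc j) t ∸ deficit R' × prefix (suc j) t ∸ deficit R' ≤ 2 * (prefix j t ∸ deficit R) + 2
    steps origin (inside _) eq = z≤n , ≤-trans (m∸n≤m _ 1) (≤-trans (≤-reflexive eq) d≤2)
    steps origin (beyond _) eq = z≤n , ≤-trans (≤-reflexive eq) d≤2
    steps (inside {j} j<r) (inside _) eq = lowered-step (prefix-β-positive j 1≤n) eq
    steps (inside {j} j<r) (beyond r<j) _ = lowered-double (prefix-β-positive j 1≤n)
      (subst (λ k → prefix (suc k) t ≡ 2 * prefix k t) (≤-antisym (s≤s⁻¹ r<j) j<r) (prefix-suc-principal (≤-trans (s≤s z≤n) j<r)))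
    steps (beyond r<j) (inside j<r) _ = ⊥-elim (<⇒≱ j<r (≤-trans (n≤1+n _) r<j))
    steps (beyond {j} _) (beyond _) eq = subst (λ p → 2 * prefix j t ≤ p × p ≤ 2 * prefix j t + 2) (sym eq)
      (m≤m+n _ d , +-monoʳ-≤ _ d≤2)

  minimum : Word
  minimum = fromPrefixes minPrefix K

  minimum-InD : InD n minimum
  minimum-InD = length-fromPrefixes K , digits-fromPrefixes minPrefix-steps ,
    trans (val-fromPrefixes refl minPrefix-steps)
      (trans (cong (prefix K t ∸_) (deficit-beyond r<K (region r K))) (trans (prefix-all K t ≤-refl) (val-β n)))

  prefix-minimum : ∀ j → prefix j minimum ≡ minPrefix j
  prefix-minimum j with j ≤? K
  ... | yes j≤K = prefix-fromPrefixes refl minPrefix-steps j≤K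
  ... | no  j≰K = trans (Lattice.prefix-beyond n minimum-InD K≤j)
    (sym (trans (cong (prefix j t ∸_) (deficit-beyond (<-≤-trans r<K K≤j) (region r j))) (Lattice.prefix-beyond n (β-InD n) K≤j)))
    where K≤j = <⇒≤ (≰⇒> j≰K)

  minimum-least : ∀ {v} → InD n v → minimum ≤ₚ v
  minimum-least {v} v∈ j = subst (_≤ prefix j v) (sym (prefix-minimum j)) (below (region r j))
    where
    below : ∀ {j} (R : Region r j) → prefix j t ∸ deficit R ≤ prefix j v
    below origin             = z≤n
    below {suc j} (inside _) = m≤n+o⇒m∸n≤o (prefix (suc j) t) 1 (β≤1+prefix v∈ (suc j))
    below (beyond r<j)       = ≤-reflexive (sym (prefix-after-principal v∈ r<j))

  minimum-isMin : IsMin n minimum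
  minimum-isMin = minimum-InD , λ v v∈ → Lattice.≤ₚ⇒≼ n minimum-InD v∈ (minimum-least v∈)

  minimum<β : ∀ {i} → 1 ≤ i → i ≤ r → prefix i minimum < prefix i t
  minimum<β {suc j} _ j<r = subst (_< prefix (suc j) t) (sym (prefix-minimum (suc j))) (lowered (region r (suc j)))
    where
    lowered : (R : Region r (suc j)) → prefix (suc j) t ∸ deficit R < prefix (suc j) t
    lowered (inside _)   = pred< (prefix-β-positive j 1≤n)
      where
      pred< : ∀ {P} → 1 ≤ P → P ∸ 1 < P
      pred< {suc P} _ = ≤-refl
    lowered (beyond r<j) = ⊥-elim (<⇒≱ j<r (s≤s⁻¹ r<j))

bottom : ℕ → Word
bottom zero    = []
bottom (suc N) = Principal.minimum (suc N) (s≤s z≤n)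

bottom-isMin : ∀ N → IsMin N (bottom N)
bottom-isMin zero    = (refl , [] , refl) , least
  where
  least : ∀ v → InD 0 v → [] ≼ v
  least [] _ = refines-refl []
bottom-isMin (suc N) = Principal.minimum-isMin (suc N) (s≤s z≤n)

module Generator (n : ℕ) (1≤n : 1 ≤ n) (i : ℕ) (1≤i : 1 ≤ i) (i≤r : i ≤ principalLength n)
            {c d : Word} (c-min : IsMin (prefix i (β n)) c) (d-min : IsMin (suffix i (β n)) d) where

  open Principal n 1≤n
  open Lattice n hiding (K)

  q m L z : ℕ
  q = prefix i t
  m = suffix i t
  L = K ∸ i
  z = K ∸ length c ∸ length d

  x : Word
  x = czd K c d

  private
    c∈ : InD q c
    c∈ = proj₁ c-min

    d∈ : InD m d
    d∈ = proj₁ d-min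

    i≤K : i ≤ K
    i≤K = ≤-trans i≤r (<⇒≤ r<K)

    length-c : length c ≡ i
    length-c = trans (proj₁ c∈) (length-β-prefix 1≤n 1≤i i≤K)

    length-d≤L : length d ≤ L
    length-d≤L = subst (_≤ L) (sym (proj₁ d∈)) (length-β≤ (suffix-β< n i))

    z≡ : z ≡ L ∸ length d
    z≡ = cong (λ ℓ → K ∸ ℓ ∸ length d) length-c

    length-zd : length (replicate z 0 ++ d) ≡ L
    length-zd = trans (length-++ (replicate z 0)) (trans (cong (_+ length d) (trans (length-replicate z) z≡)) (m∸n+n≡m length-d≤L))

  x-InD : InD n x
  x-InD = trans (length-++ c) (trans (cong₂ _+_ length-c length-zd) (m+[n∸m]≡n i≤K)) ,
          All.++⁺ (proj₁ (proj₂ c∈)) (All.++⁺ (All.replicate⁺ z z≤n) (proj₁ (proj₂ d∈))) , val-x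
    where
    open ≡-Reasoning
    zd = replicate z 0 ++ d
    val-x : val (c ++ zd) ≡ n
    val-x = begin
      val (c ++ zd)                        ≡⟨ val-++ c zd ⟩
      val c * 2 ^ length zd + val zd       ≡⟨ cong₂ (λ v ℓ → v * 2 ^ ℓ + val zd) (proj₂ (proj₂ c∈)) length-zd ⟩
      q * 2 ^ L + val zd                   ≡⟨ cong (q * 2 ^ L +_) (trans (val-zeros-++ z d) (proj₂ (proj₂ d∈))) ⟩
      q * 2 ^ L + m                        ≡⟨ β-split n i ⟨
      n                                    ∎

  prefix-x : prefix i x ≡ q
  prefix-x = trans (cong (λ k → prefix k x) (sym length-c)) (trans (cong val (take-length-++ c _)) (proj₂ (proj₂ c∈)))

  -- Splitting a after i digits, the head lies in 𝒟(q) and the tail is 0^z followed by an element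
  -- of 𝒟(m), so a dominates x = c 0^z d piece by piece.
  x-least : ∀ {a} → InD n a → prefix i a ≡ q → x ≤ₚ a
  x-least {a} a∈@(ℓa , ha , _) prefix≡ = subst (x ≤ₚ_) (sym a≡)
    (≤ₚ-++ (trans length-c (sym ℓa₁)) (trans length-zd (sym (trans (cong length (sym drop≡)) ℓa₂'))) c≤a₁
      (≤ₚ-++ refl (sym ℓa₂) (λ _ → ≤-refl) d≤a₂))
    where
    a₁ a₂ : Word
    a₁ = take i a
    a₂ = drop z (drop i a)
    ℓa₁ : length a₁ ≡ i
    ℓa₁ = length-take-≤ i a (subst (i ≤_) (sym ℓa) i≤K)
    suffix≡ : suffix i a ≡ m
    suffix≡ = prefix≡⇒suffix≡ a∈ {i} prefix≡
    ℓa₂' : length (drop i a) ≡ L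
    ℓa₂' = trans (length-drop i a) (cong (_∸ i) ℓa)
    drop≡ : drop i a ≡ replicate z 0 ++ a₂
    drop≡ = leading-zeros z (drop i a) (trans ℓa₂' (trans (sym (m∸n+n≡m length-d≤L)) (cong (_+ length d) (sym z≡))))
      (subst₂ (λ v ℓ → v < 2 ^ ℓ) (sym suffix≡) (sym (proj₁ d∈)) (β-bound m))
    ℓa₂ : length a₂ ≡ length d
    ℓa₂ = trans (length-drop z (drop i a)) (trans (cong (_∸ z) ℓa₂') (trans (cong (L ∸_) z≡) (m∸[m∸n]≡n length-d≤L)))
    a₁∈ : InD q a₁
    a₁∈ = trans ℓa₁ (sym (length-β-prefix 1≤n 1≤i i≤K)) , All.take⁺ i ha , prefix≡
    a₂∈ : InD m a₂
    a₂∈ = trans ℓa₂ (proj₁ d∈) , All.drop⁺ z (All.drop⁺ i ha) ,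
          trans (sym (val-zeros-++ z a₂)) (trans (cong val (sym drop≡)) suffix≡)
    c≤a₁ : c ≤ₚ a₁
    c≤a₁ = Lattice.≼⇒≤ₚ q c∈ a₁∈ (proj₂ c-min a₁ a₁∈)
    d≤a₂ : d ≤ₚ a₂
    d≤a₂ = Lattice.≼⇒≤ₚ m d∈ a₂∈ (proj₂ d-min a₂ a₂∈)
    a≡ : a ≡ a₁ ++ replicate z 0 ++ a₂
    a≡ = trans (sym (take++drop≡id i a)) (cong (a₁ ++_) drop≡)

  below-x : ∀ {a} → InD n a → a ≼ x → a ≡ x ⊎ prefix i a < q
  below-x {a} a∈ a≼x with prefix i a ≟ q
  ... | yes prefix≡ = inj₁ (≤ₚ-antisym a∈ x-InD a≤x (x-least a∈ prefix≡))
    where a≤x = ≼⇒≤ₚ a∈ x-InD a≼x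
  ... | no  prefix≢ = inj₂ (≤∧≢⇒< (subst (prefix i a ≤_) prefix-x (≼⇒≤ₚ a∈ x-InD a≼x i)) prefix≢)

  x-joinIrreducible : JoinIrreducible n x
  x-joinIrreducible = x-InD , not-minimum , irreducible
    where
    not-minimum : ¬ (∀ v → InD n v → x ≼ v)
    not-minimum x-least-all = <-irrefl refl (begin-strict
      q                   ≡⟨ prefix-x ⟨
      prefix i x          ≤⟨ ≼⇒≤ₚ x-InD minimum-InD (x-least-all minimum minimum-InD) i ⟩
      prefix i minimum    <⟨ minimum<β 1≤i i≤r ⟩
      q                   ∎)
      where open ≤-Reasoning
    irreducible : ∀ a b → InD n a → InD n b → IsJoin n a b x → a ≡ x ⊎ b ≡ x
    irreducible a b a∈ b∈ (_ , a≼x , b≼x , x-least-upper) with below-x a∈ a≼x | below-x b∈ b≼x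
    ... | inj₁ a≡x | _        = inj₁ a≡x
    ... | inj₂ _   | inj₁ b≡x = inj₂ b≡x
    ... | inj₂ a<q | inj₂ b<q = ⊥-elim (<-irrefl refl (begin-strict
      q                         ≡⟨ prefix-x ⟨
      prefix i x                ≤⟨ ≼⇒≤ₚ x-InD ab∈ x≼a∨b i ⟩
      prefix i (a ∨ b)          ≡⟨ prefix-∨ a∈ b∈ i ⟩
      prefix i a ⊔ prefix i b   <⟨ ⊔-lub a<q b<q ⟩
      q                         ∎))
      where
      open ≤-Reasoning
      ab∈ = ∨-InD a∈ b∈
      x≼a∨b = x-least-upper (a ∨ b) ab∈ (≤ₚ⇒≼ a∈ ab∈ (≤ₚ-∨ˡ a∈ b∈)) (≤ₚ⇒≼ b∈ ab∈ (≤ₚ-∨ʳ a∈ b∈))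

module Converse (n : ℕ) (1≤n : 1 ≤ n) {w : Word} (w-ji : JoinIrreducible n w) where

  open Principal n 1≤n
  open Lattice n hiding (K)

  generator : ℕ → Word
  generator i = czd K (bottom (prefix i t)) (bottom (suffix i t))

  private
    w∈ : InD n w
    w∈ = proj₁ w-ji

    module G {i} (1≤i : 1 ≤ i) (i≤r : i ≤ r) = Generator n 1≤n i 1≤i i≤r (bottom-isMin (prefix i t)) (bottom-isMin (suffix i t))

  saturated? : ∀ i → Dec (prefix i w ≡ prefix i t)
  saturated? i = prefix i w ≟ prefix i t

  saturated : List ℕ
  saturated = filter saturated? (applyUpTo suc r)

  generators : List Word
  generators = map generator saturated

  generators-index : ∀ {y} → y ∈ generators → ∃[ i ] 1 ≤ i × i ≤ r × prefix i w ≡ prefix i t × y ≡ generator i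
  generators-index y∈ with ∈-map⁻ generator y∈
  ... | i , i∈ , refl with ∈-filter⁻ saturated? {xs = applyUpTo suc r} i∈
  ...   | i∈range , saturated-i with ∈-applyUpTo⁻ suc i∈range
  ...     | j , j<r , refl = suc j , s≤s z≤n , j<r , saturated-i , refl

  generators-InD : All (InD n) generators
  generators-InD = tabulate λ y∈ → let i , 1≤i , i≤r , _ , y≡ = generators-index y∈ in subst (InD n) (sym y≡) (G.x-InD 1≤i i≤r)

  -- Over the principal prefix w reaches β n exactly at the saturated indices, where the
  -- corresponding generator reaches it too; elsewhere the prefixes of w are already forced.
  w≡⋁generators : w ≡ foldr _∨_ (bottom n) generators
  w≡⋁generators = ≤ₚ-antisym w∈ ⋁∈ (λ j → above (region r j))
    (foldr-∨-least bottom∈ generators-InD (≼⇒≤ₚ bottom∈ w∈ (proj₂ (bottom-isMin n) w w∈))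
      (tabulate λ y∈ → let i , 1≤i , i≤r , saturated-i , y≡ = generators-index y∈ in
        subst (_≤ₚ w) (sym y≡) (G.x-least 1≤i i≤r w∈ saturated-i)))
    where
    bottom∈ = proj₁ (bottom-isMin n)
    ⋁ = foldr _∨_ (bottom n) generators
    ⋁∈ = foldr-∨-InD bottom∈ generators-InD
    above : ∀ {j} → Region r j → prefix j w ≤ prefix j ⋁
    above origin = z≤n
    above {suc j} (inside j<r) with prefix (suc j) w ≟ prefix (suc j) t
    ... | yes saturated-j = begin
      prefix (suc j) w                   ≡⟨ trans saturated-j (sym (G.prefix-x (s≤s z≤n) j<r)) ⟩
      prefix (suc j) (generator (suc j)) ≤⟨ ∈⇒≤ₚ-foldr-∨ bottom∈ generators-InD generator∈ (suc j) ⟩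
      prefix (suc j) ⋁                   ∎
      where
      open ≤-Reasoning
      generator∈ = ∈-map⁺ generator (∈-filter⁺ saturated? (∈-applyUpTo⁺ suc j<r) saturated-j)
    ... | no  unsaturated = s≤s⁻¹ (≤-trans (≤∧≢⇒< (prefix≤β w∈ (suc j)) unsaturated) (β≤1+prefix ⋁∈ (suc j)))
    above (beyond r<j) = ≤-reflexive (trans (prefix-after-principal w∈ r<j) (sym (prefix-after-principal ⋁∈ r<j)))

  generator-index : ∃[ i ] 1 ≤ i × i ≤ r × w ≡ generator i
  generator-index = let i , 1≤i , i≤r , _ , w≡ = generators-index (joinIrreducible-∈ w-ji (bottom-isMin n) generators-InD w≡⋁generators) in
    i , 1≤i , i≤r , w≡

czd-joinIrreducible : (n : ℕ) → 1 ≤ n → (i : ℕ) → 1 ≤ i → i ≤ principalLength n →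
  (q m : ℕ) → n ≡ q * 2 ^ (length (β n) ∸ i) + m → m < 2 ^ (length (β n) ∸ i) →
  (c d : Word) → IsMin q c → IsMin m d → JoinIrreducible n (czd (length (β n)) c d)
czd-joinIrreducible n 1≤n i 1≤i i≤r q m n≡ m< c d c-min d-min
  with divmod-unique {q} {prefix i (β n)} {s = m} (trans (sym n≡) (β-split n i)) m< (suffix-β< n i)
... | refl , refl = Generator.x-joinIrreducible n 1≤n i 1≤i i≤r c-min d-min

joinIrreducible-czd : (n : ℕ) → 1 ≤ n → (w : Word) → JoinIrreducible n w →
  ∃[ i ] (1 ≤ i × i ≤ principalLength n ×
    ∃[ q ] ∃[ m ] (n ≡ q * 2 ^ (length (β n) ∸ i) + m × m < 2 ^ (length (β n) ∸ i) ×
      ∃[ c ] ∃[ d ] (IsMin q c × IsMin m d × w ≡ czd (length (β n)) c d)))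
joinIrreducible-czd n 1≤n w w-ji =
  let i , 1≤i , i≤r , w≡ = Converse.generator-index n 1≤n w-ji in
  i , 1≤i , i≤r , prefix i (β n) , suffix i (β n) , β-split n i , suffix-β< n i ,
  bottom (prefix i (β n)) , bottom (suffix i (β n)) , bottom-isMin _ , bottom-isMin _ , w≡

lemma3p13 :
    ((n : ℕ) → 1 ≤ n → (i : ℕ) → 1 ≤ i → i ≤ principalLength n →
      (q m : ℕ) → n ≡ q * 2 ^ (length (β n) ∸ i) + m → m < 2 ^ (length (β n) ∸ i) →
      (c d : Word) → IsMin q c → IsMin m d →
      JoinIrreducible n (czd (length (β n)) c d))
    ×
    ((n : ℕ) → 1 ≤ n → (w : Word) → JoinIrreducible n w →
      ∃[ i ] (1 ≤ i × i ≤ principalLength n ×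
        ∃[ q ] ∃[ m ] (n ≡ q * 2 ^ (length (β n) ∸ i) + m × m < 2 ^ (length (β n) ∸ i) ×
          ∃[ c ] ∃[ d ] (IsMin q c × IsMin m d × w ≡ czd (length (β n)) c d))))
lemma3p13 = czd-joinIrreducible , joinIrreducible-czd
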